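{- There is no uniquely $C_4^{+}$-saturated graph with exactly four triangles.
   Context: All graphs are finite, simple and undirected. $C_4^{+}$ (the diamond) is the graph obtained from a $4$-cycle by adding one chord, i.e. $K_4$ minus an edge. For a graph $H$, a graph $G$ is uniquely $H$-saturated if $G$ contains no subgraph isomorphic to $H$, but for every pair of non-adjacent vertices $u,v$ of $G$, the graph $G+uv$ contains exactly one subgraph isomorphic to $H$. A triangle is a subgraph isomorphic to $K_3$. -}

module Defs where

open import Data.Nat using (ℕ; zero; suc; _+_)
open import Data.Bool using (Bool; true; false; _∧_; _∨_; not)
open import Data.Fin using (Fin; _<?_; _≟_)
open import Data.List using (List; allFin; map)
open import Data.Nat.ListAction using (sum)
open import Data.Product using (Σ; _×_)
open import Relation.Nullary using (¬_)
open import Relation.Nullary.Decidable using (⌊_⌋)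
open import Relation.Binary.PropositionalEquality using (_≡_; _≢_)

record Graph : Set where
  field
    n      : ℕ
    adj    : Fin n → Fin n → Bool
    sym    : ∀ x y → adj x y ≡ adj y x
    irrefl : ∀ x → adj x x ≡ false
open Graph public

𝟙 : Bool → ℕ
𝟙 true  = 1
𝟙 false = 0

Σv : ∀ {n} → (Fin n → ℕ) → ℕ
Σv {n} f = sum (map f (allFin n))

_<ᵇ_ : ∀ {n} → Fin n → Fin n → Bool
x <ᵇ y = ⌊ x <? y ⌋

_≠ᵇ_ : ∀ {n} → Fin n → Fin n → Bool
x ≠ᵇ y = not ⌊ x ≟ y ⌋

-- Number of triangles (subgraphs isomorphic to K3) of an adjacency relation:
-- a triangle is determined by its vertex set {i,j,k}, enumerated once as i<j<k.
triangleCount : ∀ {n} → (Fin n → Fin n → Bool) → ℕ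
triangleCount A =
  Σv λ i → Σv λ j → Σv λ k →
    𝟙 ((i <ᵇ j) ∧ (j <ᵇ k) ∧ A i j ∧ A j k ∧ A i k)

-- Number of subgraphs isomorphic to the diamond C4+ = K4 minus an edge.
-- Such a subgraph consists of an edge bc (the chord, whose endpoints are the
-- two degree-3 vertices, hence determined by the subgraph) together with an
-- unordered pair {a,d} of further distinct vertices, each adjacent to both b
-- and c (a and d may or may not be adjacent in the host graph).  Each copy is
-- enumerated exactly once by requiring b<c and a<d.
diamondCount : ∀ {n} → (Fin n → Fin n → Bool) → ℕ
diamondCount A =
  Σv λ b → Σv λ c → Σv λ a → Σv λ d →
    𝟙 ((b <ᵇ c) ∧ (a <ᵇ d)
       ∧ (a ≠ᵇ b) ∧ (a ≠ᵇ c) ∧ (d ≠ᵇ b) ∧ (d ≠ᵇ c)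
       ∧ A b c ∧ A a b ∧ A a c ∧ A d b ∧ A d c)

addEdge : ∀ {n} → (Fin n → Fin n → Bool) → Fin n → Fin n → Fin n → Fin n → Bool
addEdge A u v x y =
  A x y ∨ (⌊ x ≟ u ⌋ ∧ ⌊ y ≟ v ⌋) ∨ (⌊ x ≟ v ⌋ ∧ ⌊ y ≟ u ⌋)

UniquelyDiamondSaturated : Graph → Set
UniquelyDiamondSaturated G =
  diamondCount (adj G) ≡ 0 ×
  (∀ (u v : Fin (n G)) → u ≢ v → adj G u v ≡ false →
     diamondCount (addEdge (adj G) u v) ≡ 1)

module Submission where

open import Data.Bool using (Bool; true; false; T; not; if_then_else_; _∧_; _∨_)
open import Data.Bool.Properties using (T-∧; T-∨; ∧-comm; ∨-comm)
open import Data.Empty using (⊥; ⊥-elim)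
open import Data.Fin using (Fin; zero; suc; _≟_; _<_)
open import Data.Fin.Properties using (any?; <-cmp; <-trans; <⇒≢)
open import Data.List using (tabulate)
open import Data.List.Properties using (map-tabulate)
open import Data.Nat using (ℕ; zero; suc; _+_; _*_; _≤_; z≤n; s≤s; s≤s⁻¹; _≤?_)
import Data.Nat.ListAction as List
open import Data.Nat.Properties
  using (≤-refl; ≤-reflexive; ≤-trans; ≤-antisym; ≰⇒>; n<1⇒n≡0; n>0⇒n≢0; n≤1⇒n≡0∨n≡1;
         m≤m+n; m≤n+m; +-mono-≤; +-monoˡ-≤; +-monoʳ-≤; +-cancelˡ-≤;
         +-comm; +-assoc; +-suc; +-identityʳ; +-cancelˡ-≡; +-cancelʳ-≡; *-zeroʳ; *-cancelˡ-≡;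
         suc-injective; m+n≡0⇒m≡0; m+n≡0⇒n≡0; +-commutativeSemigroup; +-*-semiring; module ≤-Reasoning)
open import Algebra.Properties.CommutativeSemigroup +-commutativeSemigroup using (x∙yz≈y∙xz; xy∙z≈xz∙y)
open import Algebra.Properties.Semiring.Sum +-*-semiring
  using (sum; sum-cong-≗; sum-replicate-zero; ∑-distrib-+; ∑-comm; *-distribˡ-sum)
open import Data.Nat.Tactic.RingSolver using (solve-∀)
open import Data.Product using (Σ; ∃; ∃₂; _×_; _,_; proj₁; proj₂)
open import Data.Sum using (_⊎_; inj₁; inj₂; [_,_]′)
open import Data.Unit using (tt)
open import Function using (_∘_; id; Equivalence)
open import Relation.Binary using (tri<; tri≈; tri>)
open import Relation.Binary.PropositionalEquality
  using (_≡_; _≢_; refl; sym; trans; cong; cong₂; subst; module ≡-Reasoning)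
open import Relation.Nullary using (¬_; Dec; yes; no; contradiction; map′)
open import Relation.Nullary.Decidable
  using (⌊_⌋; T?; toWitness; fromWitness; toWitnessFalse; fromWitnessFalse)

open import Defs
  using (Graph; adj; irrefl; 𝟙; Σv; _<ᵇ_; _≠ᵇ_; triangleCount; diamondCount; addEdge;
         UniquelyDiamondSaturated)

-- Every edge of a uniquely C4+-saturated graph G lies in at most one triangle, since two
-- would form a diamond.  For non-adjacent u ≠ v, a diamond of G + uv consists of uv and two
-- common neighbours of u and v, or of uc (resp. vc) and a triangle on it, for a common
-- neighbour c.  Weighting each common neighbour c by 1 + (number of triangles on uc) +
-- (number of triangles on vc), uniqueness of that diamond says the total weight is exactly
-- 2.  This already forces every vertex into at most one triangle.
--
-- Fix a triangle xyz and let A_x be the vertices adjacent to x but not to y, z (similarly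
-- A_y, A_z).  Double counting paths of length two that leave a vertex w ∈ A_x gives
-- |A_x| + τ(w) = deg w and |A_y| = deg w - 1 + τ(w), where τ(w) ∈ {0, 2} is twice the
-- number of triangles at w.  Hence |A_y| + 1 = |A_x| + 2τ(w), and two nonempty classes
-- A_x ∋ w, A_y ∋ u give 2 = 2(τ(w) + τ(u)), impossible as τ only takes even values.  If
-- two classes are empty, every vertex outside xyz is a pendant vertex at the third corner.
-- Either way no other triangle exists: G has at most one triangle, let alone four.

T-∧⁺ : ∀ {x y} → T x → T y → T (x ∧ y)
T-∧⁺ p q = Equivalence.from T-∧ (p , q)

T-∧⁻ : ∀ {x y} → T (x ∧ y) → T x × T y
T-∧⁻ = Equivalence.to T-∧

T-∨⁺ˡ : ∀ {x} y → T x → T (x ∨ y)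
T-∨⁺ˡ {true} _ _ = tt

T-∨⁺ʳ : ∀ x {y} → T y → T (x ∨ y)
T-∨⁺ʳ true  _ = tt
T-∨⁺ʳ false t = t

T-ext : ∀ {a b} → (T a → T b) → (T b → T a) → a ≡ b
T-ext {true}  {true}  _ _ = refl
T-ext {true}  {false} f _ = ⊥-elim (f tt)
T-ext {false} {true}  _ g = ⊥-elim (g tt)
T-ext {false} {false} _ _ = refl

¬T⇒≡false : ∀ {b} → ¬ T b → b ≡ false
¬T⇒≡false {true}  ¬t = contradiction tt ¬t
¬T⇒≡false {false} _  = refl

¬T⇒T-not : ∀ {b} → ¬ T b → T (not b)
¬T⇒T-not {true}  ¬t = ¬t tt
¬T⇒T-not {false} _  = tt

T-not⇒¬T : ∀ {b} → T (not b) → ¬ T b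
T-not⇒¬T {true} ()

𝟙-T : ∀ {x} → T x → 𝟙 x ≡ 1
𝟙-T {true} _ = refl

𝟙-pos⇒T : ∀ {x} → 1 ≤ 𝟙 x → T x
𝟙-pos⇒T {true} _ = tt

𝟙≤1 : ∀ x → 𝟙 x ≤ 1
𝟙≤1 true  = ≤-refl
𝟙≤1 false = z≤n

¬2≤1 : ¬ 2 ≤ 1
¬2≤1 (s≤s ())

-- Sums over Fin n

_⊙_ : Bool → ℕ → ℕ
b ⊙ m = if b then m else 0

infixr 7 _⊙_

⊙-T : ∀ {b} m → T b → b ⊙ m ≡ m
⊙-T {true} _ _ = refl

⊙-¬T : ∀ {b} m → ¬ T b → b ⊙ m ≡ 0
⊙-¬T {true}  _ ¬t = contradiction tt ¬t
⊙-¬T {false} _ _  = refl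

⊙-pos : ∀ b {m} → 1 ≤ b ⊙ m → T b × 1 ≤ m
⊙-pos true pos = tt , pos

⊙-≤ : ∀ b m → b ⊙ m ≤ m
⊙-≤ true  m = ≤-refl
⊙-≤ false m = z≤n

⊙-zeroʳ : ∀ b → b ⊙ 0 ≡ 0
⊙-zeroʳ true  = refl
⊙-zeroʳ false = refl

⊙-comm : ∀ a b m → a ⊙ b ⊙ m ≡ b ⊙ a ⊙ m
⊙-comm true  b     m = refl
⊙-comm false true  m = refl
⊙-comm false false m = refl

∧-⊙ : ∀ a b m → (a ∧ b) ⊙ m ≡ a ⊙ b ⊙ m
∧-⊙ true  b m = refl
∧-⊙ false b m = refl

⊙-+ : ∀ b m k → b ⊙ (m + k) ≡ b ⊙ m + b ⊙ k
⊙-+ true  m k = refl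
⊙-+ false m k = refl

⊙-*ˡ : ∀ b k m → b ⊙ (k * m) ≡ k * (b ⊙ m)
⊙-*ˡ true  k m = refl
⊙-*ˡ false k m = sym (*-zeroʳ k)

⊙-cong : ∀ b {m k} → (T b → m ≡ k) → b ⊙ m ≡ b ⊙ k
⊙-cong true  eq = eq tt
⊙-cong false eq = refl

≠ᵇ-suc : ∀ {n} (i j : Fin n) → (suc j ≠ᵇ suc i) ≡ (j ≠ᵇ i)
≠ᵇ-suc i j with j ≟ i
... | yes _ = refl
... | no _  = refl

≠ᵇ-⊙ : ∀ {n} {i j : Fin n} m → j ≢ i → (j ≠ᵇ i) ⊙ m ≡ m
≠ᵇ-⊙ m j≢i = ⊙-T m (fromWitnessFalse j≢i)

≠ᵇ-⊙-pos : ∀ {n} {i j : Fin n} {m} → 1 ≤ (j ≠ᵇ i) ⊙ m → j ≢ i × 1 ≤ m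
≠ᵇ-⊙-pos {i = i} {j} pos with ⊙-pos (j ≠ᵇ i) pos
... | t , m-pos = toWitnessFalse t , m-pos

count : ∀ {n} → (Fin n → Bool) → ℕ
count P = sum λ i → P i ⊙ 1

Σv≡sum : ∀ {n} (f : Fin n → ℕ) → Σv f ≡ sum f
Σv≡sum {n} f = trans (cong List.sum (map-tabulate id f)) (sum-tabulate f)
  where
  sum-tabulate : ∀ {m} (g : Fin m → ℕ) → List.sum (tabulate g) ≡ sum g
  sum-tabulate {zero}  g = refl
  sum-tabulate {suc m} g = cong (g zero +_) (sum-tabulate (g ∘ suc))

sum-zero : ∀ {n} {f : Fin n → ℕ} → (∀ i → f i ≡ 0) → sum f ≡ 0
sum-zero {n} f≗0 = trans (sum-cong-≗ f≗0) (sum-replicate-zero n)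

sum-*ˡ : ∀ {n} k (f : Fin n → ℕ) → sum (λ i → k * f i) ≡ k * sum f
sum-*ˡ k f = sym (*-distribˡ-sum k f)

term≤sum : ∀ {n} (f : Fin n → ℕ) (i : Fin n) → f i ≤ sum f
term≤sum f zero    = m≤m+n _ _
term≤sum f (suc i) = ≤-trans (term≤sum (f ∘ suc) i) (m≤n+m _ _)

≤term⇒≤sum : ∀ {n k} (f : Fin n → ℕ) i → k ≤ f i → k ≤ sum f
≤term⇒≤sum f i k≤fi = ≤-trans k≤fi (term≤sum f i)

sum-split : ∀ {n} (f : Fin n → ℕ) (i : Fin n) → sum f ≡ f i + sum (λ j → (j ≠ᵇ i) ⊙ f j)
sum-split f zero    = refl
sum-split f (suc i) = begin
  f zero + sum (f ∘ suc)                                  ≡⟨ cong (f zero +_) (sum-split (f ∘ suc) i) ⟩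
  f zero + (f (suc i) + sum (λ j → (j ≠ᵇ i) ⊙ f (suc j))) ≡⟨ x∙yz≈y∙xz (f zero) (f (suc i)) _ ⟩
  f (suc i) + (f zero + sum (λ j → (j ≠ᵇ i) ⊙ f (suc j)))
    ≡⟨ cong (λ s → f (suc i) + (f zero + s)) (sum-cong-≗ λ j → cong (_⊙ f (suc j)) (≠ᵇ-suc i j)) ⟨
  f (suc i) + sum (λ j → (j ≠ᵇ suc i) ⊙ f j)              ∎
  where open ≡-Reasoning

sum-single : ∀ {n} {f : Fin n → ℕ} (i : Fin n) → (∀ j → j ≢ i → f j ≡ 0) → sum f ≡ f i
sum-single {f = f} i others = begin
  sum f                             ≡⟨ sum-split f i ⟩
  f i + sum (λ j → (j ≠ᵇ i) ⊙ f j)  ≡⟨ cong (f i +_) (sum-zero others′) ⟩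
  f i + 0                           ≡⟨ +-identityʳ (f i) ⟩
  f i                               ∎
  where
  open ≡-Reasoning
  others′ : ∀ j → (j ≠ᵇ i) ⊙ f j ≡ 0
  others′ j with j ≟ i
  ... | yes refl = refl
  ... | no j≢i   = others j j≢i

sum-pair : ∀ {n} {f : Fin n → ℕ} (i j : Fin n) → i ≢ j →
           (∀ k → k ≢ i → k ≢ j → f k ≡ 0) → sum f ≡ f i + f j
sum-pair {f = f} i j i≢j others = begin
  sum f                             ≡⟨ sum-split f i ⟩
  f i + sum (λ k → (k ≠ᵇ i) ⊙ f k)  ≡⟨ cong (f i +_) (sum-single j others′) ⟩
  f i + (j ≠ᵇ i) ⊙ f j              ≡⟨ cong (f i +_) (≠ᵇ-⊙ (f j) (i≢j ∘ sym)) ⟩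
  f i + f j                         ∎
  where
  open ≡-Reasoning
  others′ : ∀ k → k ≢ j → (k ≠ᵇ i) ⊙ f k ≡ 0
  others′ k k≢j with k ≟ i
  ... | yes refl = refl
  ... | no k≢i   = others k k≢i k≢j

two-terms≤sum : ∀ {n} (f : Fin n → ℕ) {i j : Fin n} → i ≢ j → f i + f j ≤ sum f
two-terms≤sum f {i} {j} i≢j = begin
  f i + f j                         ≡⟨ cong (f i +_) (≠ᵇ-⊙ (f j) (i≢j ∘ sym)) ⟨
  f i + (j ≠ᵇ i) ⊙ f j              ≤⟨ +-monoʳ-≤ (f i) (term≤sum _ j) ⟩
  f i + sum (λ k → (k ≠ᵇ i) ⊙ f k)  ≡⟨ sum-split f i ⟨
  sum f                             ∎
  where open ≤-Reasoning

positive-terms⇒2≤sum : ∀ {n} (f : Fin n → ℕ) {i j} → i ≢ j → 1 ≤ f i → 1 ≤ f j → 2 ≤ sum f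
positive-terms⇒2≤sum f i≢j fi-pos fj-pos = ≤-trans (+-mono-≤ fi-pos fj-pos) (two-terms≤sum f i≢j)

positive-term : ∀ {n} (f : Fin n → ℕ) → 1 ≤ sum f → ∃ λ i → 1 ≤ f i
positive-term {suc n} f pos with 1 ≤? f zero
... | yes f₀-pos = zero , f₀-pos
... | no  f₀≯0   with positive-term (f ∘ suc) (subst (λ k → 1 ≤ k + sum (f ∘ suc)) (n<1⇒n≡0 (≰⇒> f₀≯0)) pos)
...   | i , f-pos = suc i , f-pos

another-positive-term : ∀ {n} (f : Fin n → ℕ) (i : Fin n) → f i ≤ 1 → 2 ≤ sum f → ∃ λ j → j ≢ i × 1 ≤ f j
another-positive-term f i fi≤1 two≤ with positive-term (λ j → (j ≠ᵇ i) ⊙ f j) rest-pos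
  where
  rest-pos : 1 ≤ sum (λ j → (j ≠ᵇ i) ⊙ f j)
  rest-pos = +-cancelˡ-≤ 1 _ _ (begin
    2                                   ≤⟨ two≤ ⟩
    sum f                               ≡⟨ sum-split f i ⟩
    f i + sum (λ j → (j ≠ᵇ i) ⊙ f j)    ≤⟨ +-monoˡ-≤ _ fi≤1 ⟩
    1 + sum (λ j → (j ≠ᵇ i) ⊙ f j)      ∎)
    where open ≤-Reasoning
... | j , pos = j , ≠ᵇ-⊙-pos pos

2≤sum-cases : ∀ {n} (f : Fin n → ℕ) → 2 ≤ sum f →
              (∃ λ i → 2 ≤ f i) ⊎ (∃₂ λ i j → i ≢ j × 1 ≤ f i × 1 ≤ f j)
2≤sum-cases f two≤ with positive-term f (≤-trans (s≤s z≤n) two≤)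
... | i , fi-pos with 2 ≤? f i
...   | yes two≤fi = inj₁ (i , two≤fi)
...   | no  fi≱2   with another-positive-term f i (s≤s⁻¹ (≰⇒> fi≱2)) two≤
...     | j , j≢i , fj-pos = inj₂ (i , j , j≢i ∘ sym , fi-pos , fj-pos)

member⇒1≤count : ∀ {n} (P : Fin n → Bool) {i} → T (P i) → 1 ≤ count P
member⇒1≤count P {i} Pi = ≤term⇒≤sum (λ j → P j ⊙ 1) i (≤-reflexive (sym (⊙-T 1 Pi)))

two-members⇒2≤count : ∀ {n} (P : Fin n → Bool) {i j} → i ≢ j → T (P i) → T (P j) → 2 ≤ count P
two-members⇒2≤count P i≢j Pi Pj =
  positive-terms⇒2≤sum (λ k → P k ⊙ 1) i≢j (≤-reflexive (sym (⊙-T 1 Pi))) (≤-reflexive (sym (⊙-T 1 Pj)))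

1≤count⇒member : ∀ {n} (P : Fin n → Bool) → 1 ≤ count P → ∃ λ i → T (P i)
1≤count⇒member P pos with positive-term (λ j → P j ⊙ 1) pos
... | i , Pi-pos = i , proj₁ (⊙-pos (P i) Pi-pos)

unique⇒count≤1 : ∀ {n} (P : Fin n → Bool) → (∀ {i j} → T (P i) → T (P j) → i ≡ j) → count P ≤ 1
unique⇒count≤1 P unique with count P ≤? 1
... | yes ≤1 = ≤1
... | no  ≰1 with 2≤sum-cases (λ j → P j ⊙ 1) (≰⇒> ≰1)
...   | inj₁ (i , two≤) = contradiction (≤-trans two≤ (⊙-≤ (P i) 1)) ¬2≤1
...   | inj₂ (i , j , i≢j , Pi-pos , Pj-pos) =
        contradiction (unique (proj₁ (⊙-pos (P i) Pi-pos)) (proj₁ (⊙-pos (P j) Pj-pos))) i≢j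

count≤1⇒unique : ∀ {n} (P : Fin n → Bool) → count P ≤ 1 → ∀ {i j} → T (P i) → T (P j) → i ≡ j
count≤1⇒unique P count≤1 {i} {j} Pi Pj with i ≟ j
... | yes i≡j = i≡j
... | no  i≢j = contradiction (≤-trans (two-members⇒2≤count P i≢j Pi Pj) count≤1) ¬2≤1

⊙-sum : ∀ {n} b (f : Fin n → ℕ) → b ⊙ sum f ≡ sum (λ i → b ⊙ f i)
⊙-sum true  f = refl
⊙-sum false f = sym (sum-zero {f = λ i → false ⊙ f i} λ _ → refl)

sum-⊙-cong : ∀ {n} (P : Fin n → Bool) {f g : Fin n → ℕ} → (∀ i → T (P i) → f i ≡ g i) →
             sum (λ i → P i ⊙ f i) ≡ sum (λ i → P i ⊙ g i)
sum-⊙-cong P f≗g = sum-cong-≗ λ i → ⊙-cong (P i) (f≗g i)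

sum-⊙-suc : ∀ {n} (P : Fin n → Bool) (g : Fin n → ℕ) →
            sum (λ i → P i ⊙ suc (g i)) ≡ count P + sum (λ i → P i ⊙ g i)
sum-⊙-suc P g = trans (sum-cong-≗ λ i → ⊙-+ (P i) 1 (g i)) (∑-distrib-+ (λ i → P i ⊙ 1) (λ i → P i ⊙ g i))

double-count : ∀ {m n} (P : Fin m → Bool) (Q : Fin n → Bool) (f : Fin m → Fin n → ℕ) →
               sum (λ i → P i ⊙ sum (λ j → Q j ⊙ f i j)) ≡ sum (λ j → Q j ⊙ sum (λ i → P i ⊙ f i j))
double-count P Q f = begin
  sum (λ i → P i ⊙ sum (λ j → Q j ⊙ f i j))
    ≡⟨ sum-cong-≗ (λ i → ⊙-sum (P i) (λ j → Q j ⊙ f i j)) ⟩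
  sum (λ i → sum (λ j → P i ⊙ Q j ⊙ f i j))
    ≡⟨ ∑-comm (λ i j → P i ⊙ Q j ⊙ f i j) ⟩
  sum (λ j → sum (λ i → P i ⊙ Q j ⊙ f i j))
    ≡⟨ sum-cong-≗ (λ j → sum-cong-≗ λ i → ⊙-comm (P i) (Q j) (f i j)) ⟩
  sum (λ j → sum (λ i → Q j ⊙ P i ⊙ f i j))
    ≡⟨ sum-cong-≗ (λ j → ⊙-sum (Q j) (λ i → P i ⊙ f i j)) ⟨
  sum (λ j → Q j ⊙ sum (λ i → P i ⊙ f i j))
    ∎
  where open ≡-Reasoning

-- Members of P weighted by 1 + g with total weight 2: either P = {w} with g w = 1, or P has
-- two members and g vanishes on them.
weighted-count≡2 : ∀ {n} (P : Fin n → Bool) (g : Fin n → ℕ) {w} →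
                   sum (λ i → P i ⊙ suc (g i)) ≡ 2 → T (P w) → count P + g w ≡ 2
weighted-count≡2 P g {w} total Pw = arith (count P) G (g w)
    (trans (sym (sum-⊙-suc P g)) total)
    (≤term⇒≤sum (λ i → P i ⊙ g i) w (≤-reflexive (sym (⊙-T (g w) Pw))))
    (member⇒1≤count P Pw) lonely
  where
  G : ℕ
  G = sum (λ i → P i ⊙ g i)
  lonely : g w ≡ 0 → count P ≡ 1 → G ≡ 1 → ⊥
  lonely gw≡0 count≡1 G≡1 with positive-term (λ i → P i ⊙ g i) (≤-reflexive (sym G≡1))
  ... | i , pos with ⊙-pos (P i) pos
  ...   | Pi , gi-pos = contradiction (subst (2 ≤_) count≡1 (two-members⇒2≤count P i≢w Pi Pw)) ¬2≤1
    where
    i≢w : i ≢ w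
    i≢w refl = n>0⇒n≢0 gi-pos gw≡0
  arith : ∀ k s t → k + s ≡ 2 → t ≤ s → 1 ≤ k → (t ≡ 0 → k ≡ 1 → s ≡ 1 → ⊥) → k + t ≡ 2
  arith 1 1 0             _ _        _ excluded = ⊥-elim (excluded refl refl refl)
  arith 1 1 1             _ _        _ _        = refl
  arith 2 0 0             _ _        _ _        = refl
  arith 1 1 (suc (suc _)) _ (s≤s ()) _ _

weighted-count≡2⇒singleton : ∀ {n} (P : Fin n → Bool) (g : Fin n → ℕ) {w} →
  sum (λ i → P i ⊙ suc (g i)) ≡ 2 → T (P w) → 1 ≤ g w → count P ≡ 1 × g w ≡ 1
weighted-count≡2⇒singleton P g {w} total Pw gw-pos =
  arith (count P) (g w) (weighted-count≡2 P g total Pw) (member⇒1≤count P Pw) gw-pos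
  where
  arith : ∀ k t → k + t ≡ 2 → 1 ≤ k → 1 ≤ t → k ≡ 1 × t ≡ 1
  arith (suc k) (suc t) eq _ _ =
    let k+t≡0 = suc-injective (trans (sym (+-suc k t)) (suc-injective eq))
    in cong suc (m+n≡0⇒m≡0 k k+t≡0) , cong suc (m+n≡0⇒n≡0 k k+t≡0)

-- Counting diamonds

SamePair : ∀ {n} → Fin n → Fin n → Fin n → Fin n → Set
SamePair r s p q = (r ≡ p × s ≡ q) ⊎ (r ≡ q × s ≡ p)

Σ⁴ : ∀ {n} → (Fin n → Fin n → Fin n → Fin n → ℕ) → ℕ
Σ⁴ F = sum λ b → sum λ c → sum λ a → sum λ d → F b c a d

two-terms≤Σ⁴ : ∀ {n} (F : Fin n → Fin n → Fin n → Fin n → ℕ) {b c a d b′ c′ a′ d′} →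
               ¬ (b ≡ b′ × c ≡ c′ × a ≡ a′ × d ≡ d′) → 1 ≤ F b c a d → 1 ≤ F b′ c′ a′ d′ → 2 ≤ Σ⁴ F
two-terms≤Σ⁴ F {b} {c} {a} {d} {b′} {c′} {a′} {d′} differ p p′
  with b ≟ b′ | c ≟ c′ | a ≟ a′ | d ≟ d′
... | no b≢b′ | _ | _ | _ = positive-terms⇒2≤sum _ b≢b′
  (≤term⇒≤sum _ c (≤term⇒≤sum _ a (≤term⇒≤sum _ d p)))
  (≤term⇒≤sum _ c′ (≤term⇒≤sum _ a′ (≤term⇒≤sum _ d′ p′)))
... | yes refl | no c≢c′ | _ | _ = ≤term⇒≤sum _ b (positive-terms⇒2≤sum _ c≢c′
  (≤term⇒≤sum _ a (≤term⇒≤sum _ d p)) (≤term⇒≤sum _ a′ (≤term⇒≤sum _ d′ p′)))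
... | yes refl | yes refl | no a≢a′ | _ = ≤term⇒≤sum _ b (≤term⇒≤sum _ c (positive-terms⇒2≤sum _ a≢a′
  (≤term⇒≤sum _ d p) (≤term⇒≤sum _ d′ p′)))
... | yes refl | yes refl | yes refl | no d≢d′ =
  ≤term⇒≤sum _ b (≤term⇒≤sum _ c (≤term⇒≤sum _ a (positive-terms⇒2≤sum _ d≢d′ p p′)))
... | yes refl | yes refl | yes refl | yes refl = contradiction (refl , refl , refl , refl) differ

module DiamondCounting {n : ℕ} (B : Fin n → Fin n → Bool)
  (B-sym : ∀ x y → B x y ≡ B y x) (B-irrefl : ∀ x → B x x ≡ false) where

  private
    V : Set
    V = Fin n

  Edge : V → V → Set
  Edge x y = T (B x y)

  edge-sym : ∀ {x y} → Edge x y → Edge y x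
  edge-sym {x} {y} = subst T (B-sym x y)

  edge⇒≢ : ∀ {x y} → Edge x y → x ≢ y
  edge⇒≢ {x} e refl = subst T (B-irrefl x) e

  -- The chord is bc, the tips are a and d.
  record Diamond (b c a d : V) : Set where
    constructor diamond
    field
      b~c : Edge b c
      a~b : Edge a b
      a~c : Edge a c
      d~b : Edge d b
      d~c : Edge d c
      a≢d : a ≢ d

  swap-chord : ∀ {b c a d} → Diamond b c a d → Diamond c b a d
  swap-chord (diamond bc ab ac db dc a≢d) = diamond (edge-sym bc) ac ab dc db a≢d

  swap-tips : ∀ {b c a d} → Diamond b c a d → Diamond b c d a
  swap-tips (diamond bc ab ac db dc a≢d) = diamond bc db dc ab ac (a≢d ∘ sym)

  term : V → V → V → V → ℕ
  term b c a d = 𝟙 ((b <ᵇ c) ∧ (a <ᵇ d) ∧ (a ≠ᵇ b) ∧ (a ≠ᵇ c) ∧ (d ≠ᵇ b) ∧ (d ≠ᵇ c)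
                    ∧ B b c ∧ B a b ∧ B a c ∧ B d b ∧ B d c)

  diamondCount≡Σ⁴ : diamondCount B ≡ Σ⁴ term
  diamondCount≡Σ⁴ =
    trans (Σv≡sum λ b → Σv λ c → Σv λ a → Σv λ d → term b c a d) (sum-cong-≗ λ b →
    trans (Σv≡sum λ c → Σv λ a → Σv λ d → term b c a d) (sum-cong-≗ λ c →
    trans (Σv≡sum λ a → Σv λ d → term b c a d) (sum-cong-≗ λ a →
    Σv≡sum λ d → term b c a d)))

  term-diamond : ∀ {b c a d} → 1 ≤ term b c a d → Diamond b c a d
  term-diamond {b} {c} {a} {d} pos =
    let _   , t  = T-∧⁻ {b <ᵇ c} (𝟙-pos⇒T pos)
        a<d , t  = T-∧⁻ {a <ᵇ d} t
        _   , t  = T-∧⁻ {a ≠ᵇ b} t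
        _   , t  = T-∧⁻ {a ≠ᵇ c} t
        _   , t  = T-∧⁻ {d ≠ᵇ b} t
        _   , t  = T-∧⁻ {d ≠ᵇ c} t
        bc  , t  = T-∧⁻ {B b c} t
        ab  , t  = T-∧⁻ {B a b} t
        ac  , t  = T-∧⁻ {B a c} t
        db  , dc = T-∧⁻ {B d b} t
    in diamond bc ab ac db dc (<⇒≢ (toWitness a<d))

  diamond-term : ∀ {b c a d} → b < c → a < d → Diamond b c a d → term b c a d ≡ 1
  diamond-term {b} {c} {a} {d} b<c a<d (diamond bc ab ac db dc _) = 𝟙-T
    (T-∧⁺ {b <ᵇ c} (fromWitness b<c) (T-∧⁺ {a <ᵇ d} (fromWitness a<d)
    (T-∧⁺ {a ≠ᵇ b} (fromWitnessFalse (edge⇒≢ ab)) (T-∧⁺ {a ≠ᵇ c} (fromWitnessFalse (edge⇒≢ ac))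
    (T-∧⁺ {d ≠ᵇ b} (fromWitnessFalse (edge⇒≢ db)) (T-∧⁺ {d ≠ᵇ c} (fromWitnessFalse (edge⇒≢ dc))
    (T-∧⁺ {B b c} bc (T-∧⁺ {B a b} ab (T-∧⁺ {B a c} ac (T-∧⁺ {B d b} db dc))))))))))

  sort-pair : ∀ {p q} → p ≢ q → ∃₂ λ (r s : V) → r < s × SamePair r s p q
  sort-pair {p} {q} p≢q with <-cmp p q
  ... | tri< p<q _ _   = p , q , p<q , inj₁ (refl , refl)
  ... | tri≈ _ p≡q _   = contradiction p≡q p≢q
  ... | tri> _ _ q<p   = q , p , q<p , inj₂ (refl , refl)

  second∈ : ∀ {r s p q p′ q′ : V} → SamePair r s p q → SamePair r s p′ q′ → q′ ≡ p ⊎ q′ ≡ q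
  second∈ (inj₁ (refl , refl)) (inj₁ (refl , refl)) = inj₂ refl
  second∈ (inj₁ (refl , refl)) (inj₂ (refl , refl)) = inj₁ refl
  second∈ (inj₂ (refl , refl)) (inj₁ (refl , refl)) = inj₁ refl
  second∈ (inj₂ (refl , refl)) (inj₂ (refl , refl)) = inj₂ refl

  resort : ∀ {b c a d r s α δ} → SamePair r s b c → SamePair α δ a d →
           Diamond b c a d → Diamond r s α δ
  resort (inj₁ (refl , refl)) (inj₁ (refl , refl)) = id
  resort (inj₁ (refl , refl)) (inj₂ (refl , refl)) = swap-tips
  resort (inj₂ (refl , refl)) (inj₁ (refl , refl)) = swap-chord
  resort (inj₂ (refl , refl)) (inj₂ (refl , refl)) = swap-tips ∘ swap-chord

  record Sorted (b c a d : V) : Set where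
    constructor sorted
    field
      {r s α δ} : V
      r<s       : r < s
      α<δ       : α < δ
      chord≈    : SamePair r s b c
      tips≈     : SamePair α δ a d
      term≡1    : term r s α δ ≡ 1

  sort : ∀ {b c a d} → Diamond b c a d → Sorted b c a d
  sort D with sort-pair (edge⇒≢ (Diamond.b~c D)) | sort-pair (Diamond.a≢d D)
  ... | _ , _ , r<s , chord≈ | _ , _ , α<δ , tips≈ =
    sorted r<s α<δ chord≈ tips≈ (diamond-term r<s α<δ (resort chord≈ tips≈ D))

  diamond⇒1≤count : ∀ {b c a d} → Diamond b c a d → 1 ≤ diamondCount B
  diamond⇒1≤count D with sort D
  ... | sorted {r} {s} {α} {δ} _ _ _ _ term≡1 = subst (1 ≤_) (sym diamondCount≡Σ⁴)
    (≤term⇒≤sum _ r (≤term⇒≤sum _ s (≤term⇒≤sum _ α (≤term⇒≤sum _ δ (≤-reflexive (sym term≡1))))))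

  1≤count⇒diamond : 1 ≤ diamondCount B → ∃₂ λ b c → ∃₂ λ a d → Diamond b c a d
  1≤count⇒diamond pos with positive-term _ (subst (1 ≤_) diamondCount≡Σ⁴ pos)
  ... | b , pos with positive-term _ pos
  ... | c , pos with positive-term _ pos
  ... | a , pos with positive-term _ pos
  ... | d , pos = b , c , a , d , term-diamond pos

  distinct-diamonds⇒2≤count : ∀ {b c a d b′ c′ a′ d′} → Diamond b c a d → Diamond b′ c′ a′ d′ →
                              (c′ ≢ b × c′ ≢ c) ⊎ (d′ ≢ a × d′ ≢ d) → 2 ≤ diamondCount B
  distinct-diamonds⇒2≤count {b} {c} {a} {d} {b′} {c′} {a′} {d′} D D′ differ with sort D | sort D′
  ... | sorted {r} {s} {α} {δ} _ _ chord≈ tips≈ t≡1 | sorted {r′} {s′} {α′} {δ′} _ _ chord≈′ tips≈′ t≡1′ =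
    subst (2 ≤_) (sym diamondCount≡Σ⁴)
      (two-terms≤Σ⁴ term positions-differ (≤-reflexive (sym t≡1)) (≤-reflexive (sym t≡1′)))
    where
    positions-differ : ¬ (r ≡ r′ × s ≡ s′ × α ≡ α′ × δ ≡ δ′)
    positions-differ (refl , refl , refl , refl) = [ chord-differs , tips-differ ]′ differ
      where
      chord-differs : c′ ≢ b × c′ ≢ c → ⊥
      chord-differs (c′≢b , c′≢c) = [ c′≢b , c′≢c ]′ (second∈ chord≈ chord≈′)
      tips-differ : d′ ≢ a × d′ ≢ d → ⊥
      tips-differ (d′≢a , d′≢d) = [ d′≢a , d′≢d ]′ (second∈ tips≈ tips≈′)

-- Uniquely diamond-saturated graphs

module UniquelySaturated {n : ℕ} (A : Fin n → Fin n → Bool)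
  (A-sym : ∀ x y → A x y ≡ A y x) (A-irrefl : ∀ x → A x x ≡ false)
  (diamond-free : diamondCount A ≡ 0)
  (unique : ∀ u v → u ≢ v → A u v ≡ false → diamondCount (addEdge A u v) ≡ 1) where

  private
    V : Set
    V = Fin n
    module G = DiamondCounting A A-sym A-irrefl

  open G using () renaming (Edge to _~_; edge-sym to ~-sym; edge⇒≢ to ~⇒≢)

  _≁_ : V → V → Set
  x ≁ y = ¬ x ~ y

  apex-unique : ∀ {x y a d} → x ~ y → a ~ x → a ~ y → d ~ x → d ~ y → a ≡ d
  apex-unique {a = a} {d} xy ax ay dx dy with a ≟ d
  ... | yes a≡d = a≡d
  ... | no  a≢d = ⊥-elim (n>0⇒n≢0 (G.diamond⇒1≤count (G.diamond xy ax ay dx dy a≢d)) diamond-free)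

  common : V → V → V → Bool
  common p q c = A p c ∧ A q c

  codeg : V → V → ℕ
  codeg p q = count (common p q)

  codeg-sym : ∀ p q → codeg p q ≡ codeg q p
  codeg-sym p q = sum-cong-≗ λ c → cong (_⊙ 1) (∧-comm (A p c) (A q c))

  common⇒1≤codeg : ∀ {p q c} → p ~ c → q ~ c → 1 ≤ codeg p q
  common⇒1≤codeg {p} {q} pc qc = member⇒1≤count (common p q) (T-∧⁺ pc qc)

  1≤codeg⇒common : ∀ {p q} → 1 ≤ codeg p q → ∃ λ c → p ~ c × q ~ c
  1≤codeg⇒common {p} {q} pos with 1≤count⇒member (common p q) pos
  ... | c , t = c , T-∧⁻ t

  no-common⇒codeg≡0 : ∀ {p q} → (∀ {c} → p ~ c → q ~ c → ⊥) → codeg p q ≡ 0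
  no-common⇒codeg≡0 {p} {q} none = sum-zero {f = λ c → common p q c ⊙ 1} λ c →
    ⊙-¬T 1 λ t → let pc , qc = T-∧⁻ t in none pc qc

  codeg≤1 : ∀ {p q} → p ~ q → codeg p q ≤ 1
  codeg≤1 {p} {q} pq = unique⇒count≤1 (common p q) λ ti tj → let pi , qi = T-∧⁻ ti ; pj , qj = T-∧⁻ tj in
    apex-unique pq (~-sym pi) (~-sym qi) (~-sym pj) (~-sym qj)

  codeg≡1 : ∀ {p q c} → p ~ q → p ~ c → q ~ c → codeg p q ≡ 1
  codeg≡1 pq pc qc = ≤-antisym (codeg≤1 pq) (common⇒1≤codeg pc qc)

  pathWeight : V → V → V → ℕ
  pathWeight u v c = common u v c ⊙ suc (codeg u c + codeg v c)

  pathWeight-sym : ∀ u v c → pathWeight u v c ≡ pathWeight v u c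
  pathWeight-sym u v c = cong₂ _⊙_ (∧-comm (A u c) (A v c)) (cong suc (+-comm (codeg u c) (codeg v c)))

  -- The diamond of G + uv through uv: uv is its chord with tips c, c′, or uc (resp. vc) is
  -- its chord with tips v, d (resp. u, d).
  data NewDiamond (u v : V) : Set where
    tips  : ∀ {c c′} → c ≢ c′ → u ~ c × v ~ c → u ~ c′ × v ~ c′ → NewDiamond u v
    sideᵤ : ∀ {c d} → u ~ c × v ~ c → u ~ d → c ~ d → NewDiamond u v
    sideᵥ : ∀ {c d} → u ~ c × v ~ c → v ~ d → c ~ d → NewDiamond u v

  module NewEdge {u v : V} (u≢v : u ≢ v) (u≁v : u ≁ v) where

    B : V → V → Bool
    B = addEdge A u v

    B-sym : ∀ x y → B x y ≡ B y x
    B-sym x y = cong₂ _∨_ (A-sym x y) (trans (∨-comm (⌊ x ≟ u ⌋ ∧ ⌊ y ≟ v ⌋) (⌊ x ≟ v ⌋ ∧ ⌊ y ≟ u ⌋))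
      (cong₂ _∨_ (∧-comm ⌊ x ≟ v ⌋ ⌊ y ≟ u ⌋) (∧-comm ⌊ x ≟ u ⌋ ⌊ y ≟ v ⌋)))

    B-irrefl : ∀ x → B x x ≡ false
    B-irrefl x rewrite A-irrefl x with x ≟ u | x ≟ v
    ... | yes refl | yes u≡v = contradiction u≡v u≢v
    ... | yes _    | no _    = refl
    ... | no _     | yes _   = refl
    ... | no _     | no _    = refl

    module G+uv = DiamondCounting B B-sym B-irrefl
    open G+uv using (Diamond; diamond; swap-chord; swap-tips) renaming (Edge to _~⁺_)

    old : ∀ {x y} → x ~ y → x ~⁺ y
    old {x} {y} xy = T-∨⁺ˡ (⌊ x ≟ u ⌋ ∧ ⌊ y ≟ v ⌋ ∨ ⌊ x ≟ v ⌋ ∧ ⌊ y ≟ u ⌋) xy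

    new : u ~⁺ v
    new = T-∨⁺ʳ (A u v)
            (T-∨⁺ˡ (⌊ u ≟ v ⌋ ∧ ⌊ v ≟ u ⌋) (T-∧⁺ {⌊ u ≟ u ⌋} (fromWitness refl) (fromWitness refl)))

    old-or-new : ∀ {x y} → x ~⁺ y → x ~ y ⊎ SamePair x y u v
    old-or-new {x} {y} xy
      with Equivalence.to (T-∨ {A x y} {⌊ x ≟ u ⌋ ∧ ⌊ y ≟ v ⌋ ∨ ⌊ x ≟ v ⌋ ∧ ⌊ y ≟ u ⌋}) xy
    ... | inj₁ x~y = inj₁ x~y
    ... | inj₂ t with Equivalence.to (T-∨ {⌊ x ≟ u ⌋ ∧ ⌊ y ≟ v ⌋} {⌊ x ≟ v ⌋ ∧ ⌊ y ≟ u ⌋}) t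
    ...   | inj₁ t′ = let x≡u , y≡v = T-∧⁻ {⌊ x ≟ u ⌋} t′ in inj₂ (inj₁ (toWitness x≡u , toWitness y≡v))
    ...   | inj₂ t′ = let x≡v , y≡u = T-∧⁻ {⌊ x ≟ v ⌋} t′ in inj₂ (inj₂ (toWitness x≡v , toWitness y≡u))

    off-new : ∀ {x y} → x ≢ u × x ≢ v → x ~⁺ y → x ~ y
    off-new (x≢u , x≢v) xy with old-or-new xy
    ... | inj₁ x~y              = x~y
    ... | inj₂ (inj₁ (x≡u , _)) = contradiction x≡u x≢u
    ... | inj₂ (inj₂ (x≡v , _)) = contradiction x≡v x≢v

    outside : ∀ {x p q} → SamePair p q u v → x ≢ p → x ≢ q → x ≢ u × x ≢ v
    outside (inj₁ (refl , refl)) x≢p x≢q = x≢p , x≢q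
    outside (inj₂ (refl , refl)) x≢p x≢q = x≢q , x≢p

    no-old-diamond : ∀ {b c a d} → G.Diamond b c a d → ⊥
    no-old-diamond D = n>0⇒n≢0 (G.diamond⇒1≤count D) diamond-free

    some-new-edge : ∀ {b c a d} → Diamond b c a d →
      SamePair b c u v ⊎ SamePair a b u v ⊎ SamePair a c u v ⊎ SamePair d b u v ⊎ SamePair d c u v
    some-new-edge (diamond bc ab ac db dc a≢d)
      with old-or-new bc | old-or-new ab | old-or-new ac | old-or-new db | old-or-new dc
    ... | inj₂ e | _      | _      | _      | _      = inj₁ e
    ... | inj₁ _ | inj₂ e | _      | _      | _      = inj₂ (inj₁ e)
    ... | inj₁ _ | inj₁ _ | inj₂ e | _      | _      = inj₂ (inj₂ (inj₁ e))
    ... | inj₁ _ | inj₁ _ | inj₁ _ | inj₂ e | _      = inj₂ (inj₂ (inj₂ (inj₁ e)))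
    ... | inj₁ _ | inj₁ _ | inj₁ _ | inj₁ _ | inj₂ e = inj₂ (inj₂ (inj₂ (inj₂ e)))
    ... | inj₁ bc′ | inj₁ ab′ | inj₁ ac′ | inj₁ db′ | inj₁ dc′ =
      ⊥-elim (no-old-diamond (G.diamond bc′ ab′ ac′ db′ dc′ a≢d))

    both-ends : ∀ {b c x} → SamePair b c u v → b ~ x → c ~ x → u ~ x × v ~ x
    both-ends (inj₁ (refl , refl)) bx cx = bx , cx
    both-ends (inj₂ (refl , refl)) bx cx = cx , bx

    new-chord : ∀ {b c a d} → Diamond b c a d → SamePair b c u v → NewDiamond u v
    new-chord {b} {c} {a} {d} (diamond bc ab ac db dc a≢d) bc-new =
      tips a≢d (both-ends bc-new (~-sym (off-new a-out ab)) (~-sym (off-new a-out ac)))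
               (both-ends bc-new (~-sym (off-new d-out db)) (~-sym (off-new d-out dc)))
      where
      a-out : a ≢ u × a ≢ v
      a-out = outside bc-new (G+uv.edge⇒≢ ab) (G+uv.edge⇒≢ ac)
      d-out : d ≢ u × d ≢ v
      d-out = outside bc-new (G+uv.edge⇒≢ db) (G+uv.edge⇒≢ dc)

    orient-side : ∀ {a b c d} → SamePair a b u v → a ~ c → b ~ c → d ~ b → c ~ d → NewDiamond u v
    orient-side (inj₁ (refl , refl)) ac bc db cd = sideᵥ (ac , bc) (~-sym db) cd
    orient-side (inj₂ (refl , refl)) ac bc db cd = sideᵤ (bc , ac) (~-sym db) cd

    new-side : ∀ {b c a d} → Diamond b c a d → SamePair a b u v → NewDiamond u v
    new-side {b} {c} {a} {d} (diamond bc ab ac db dc a≢d) ab-new =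
      orient-side ab-new (~-sym (off-new c-out (G+uv.edge-sym ac))) (~-sym (off-new c-out (G+uv.edge-sym bc)))
                         (off-new d-out db) (~-sym (off-new d-out dc))
      where
      c-out : c ≢ u × c ≢ v
      c-out = outside ab-new (G+uv.edge⇒≢ ac ∘ sym) (G+uv.edge⇒≢ bc ∘ sym)
      d-out : d ≢ u × d ≢ v
      d-out = outside ab-new (a≢d ∘ sym) (G+uv.edge⇒≢ db)

    classify : ∀ {b c a d} → Diamond b c a d → NewDiamond u v
    classify D with some-new-edge D
    ... | inj₁ e                         = new-chord D e
    ... | inj₂ (inj₁ e)                  = new-side D e
    ... | inj₂ (inj₂ (inj₁ e))           = new-side (swap-chord D) e
    ... | inj₂ (inj₂ (inj₂ (inj₁ e)))    = new-side (swap-tips D) e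
    ... | inj₂ (inj₂ (inj₂ (inj₂ e)))    = new-side (swap-tips (swap-chord D)) e

    unique-count : diamondCount B ≡ 1
    unique-count = unique u v u≢v (¬T⇒≡false u≁v)

    the-new-diamond : NewDiamond u v
    the-new-diamond = let _ , _ , _ , _ , D = G+uv.1≤count⇒diamond one≤count in classify D
      where
      one≤count : 1 ≤ diamondCount B
      one≤count = subst (1 ≤_) (sym unique-count) (s≤s z≤n)

    conflict : ∀ {b c a d b′ c′ a′ d′} → Diamond b c a d → Diamond b′ c′ a′ d′ →
               (c′ ≢ b × c′ ≢ c) ⊎ (d′ ≢ a × d′ ≢ d) → ⊥
    conflict D D′ differ = ¬2≤1 (subst (2 ≤_) unique-count (G+uv.distinct-diamonds⇒2≤count D D′ differ))

    tips-diamond : ∀ {c c′} → c ≢ c′ → u ~ c × v ~ c → u ~ c′ × v ~ c′ → Diamond u v c c′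
    tips-diamond c≢c′ (uc , vc) (uc′ , vc′) =
      diamond new (old (~-sym uc)) (old (~-sym vc)) (old (~-sym uc′)) (old (~-sym vc′)) c≢c′

    sideᵤ-diamond : ∀ {c d} → u ~ c × v ~ c → u ~ d → c ~ d → Diamond u c v d
    sideᵤ-diamond (uc , vc) ud cd =
      diamond (old uc) (G+uv.edge-sym new) (old vc) (old (~-sym ud)) (old (~-sym cd)) λ { refl → u≁v ud }

    sideᵥ-diamond : ∀ {c d} → u ~ c × v ~ c → v ~ d → c ~ d → Diamond v c u d
    sideᵥ-diamond (uc , vc) vd cd =
      diamond (old vc) new (old uc) (old (~-sym vd)) (old (~-sym cd)) λ { refl → u≁v (~-sym vd) }

    weight-at : ∀ {c k l} → u ~ c × v ~ c → codeg u c ≡ k → codeg v c ≡ l → pathWeight u v c ≡ suc (k + l)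
    weight-at (uc , vc) refl refl = ⊙-T _ (T-∧⁺ uc vc)

    no-weight : ∀ {c} → ¬ (u ~ c × v ~ c) → pathWeight u v c ≡ 0
    no-weight ¬common = ⊙-¬T _ (¬common ∘ T-∧⁻)

    tips-total : ∀ {c c′} → c ≢ c′ → u ~ c × v ~ c → u ~ c′ × v ~ c′ → sum (pathWeight u v) ≡ 2
    tips-total {c} {c′} c≢c′ cc cc′ =
      trans (sum-pair c c′ c≢c′ others) (cong₂ _+_ (lonely cc) (lonely cc′))
      where
      D : Diamond u v c c′
      D = tips-diamond c≢c′ cc cc′
      others : ∀ k → k ≢ c → k ≢ c′ → pathWeight u v k ≡ 0
      others k k≢c k≢c′ = no-weight λ ck → conflict D (tips-diamond (k≢c ∘ sym) cc ck) (inj₂ (k≢c , k≢c′))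
      lonely : ∀ {x} → u ~ x × v ~ x → pathWeight u v x ≡ 1
      lonely {x} cx@(ux , vx) = weight-at cx
        (no-common⇒codeg≡0 λ ud xd → conflict D (sideᵤ-diamond cx ud xd) (inj₁ x∉uv))
        (no-common⇒codeg≡0 λ vd xd → conflict D (sideᵥ-diamond cx vd xd) (inj₁ x∉uv))
        where
        x∉uv : x ≢ u × x ≢ v
        x∉uv = ~⇒≢ ux ∘ sym , ~⇒≢ vx ∘ sym

    sideᵤ-total : ∀ {c d} → u ~ c × v ~ c → u ~ d → c ~ d → sum (pathWeight u v) ≡ 2
    sideᵤ-total {c} {d} cc@(uc , vc) ud cd = trans (sum-single c others) (weight-at cc (codeg≡1 uc ud cd)
      (no-common⇒codeg≡0 λ vd′ cd′ → conflict D (swap-chord (sideᵥ-diamond cc vd′ cd′)) (inj₁ v∉uc)))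
      where
      D : Diamond u c v d
      D = sideᵤ-diamond cc ud cd
      v∉uc : v ≢ u × v ≢ c
      v∉uc = u≢v ∘ sym , ~⇒≢ vc
      others : ∀ k → k ≢ c → pathWeight u v k ≡ 0
      others k k≢c = no-weight λ ck → conflict D (tips-diamond (k≢c ∘ sym) cc ck) (inj₁ v∉uc)

  pathWeights≡2 : ∀ {u v} → u ≢ v → u ≁ v → sum (pathWeight u v) ≡ 2
  pathWeights≡2 {u} {v} u≢v u≁v = by-kind (NewEdge.the-new-diamond u≢v u≁v)
    where
    by-kind : NewDiamond u v → sum (pathWeight u v) ≡ 2
    by-kind (tips c≢c′ cc cc′)      = NewEdge.tips-total u≢v u≁v c≢c′ cc cc′
    by-kind (sideᵤ cc ud cd)        = NewEdge.sideᵤ-total u≢v u≁v cc ud cd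
    by-kind (sideᵥ (uc , vc) vd cd) = trans (sum-cong-≗ (pathWeight-sym u v))
                                        (NewEdge.sideᵤ-total (u≢v ∘ sym) (u≁v ∘ ~-sym) (vc , uc) vd cd)

  Triangle : V → V → V → Set
  Triangle x y z = x ~ y × y ~ z × x ~ z

  swap₁₂ : ∀ {x y z} → Triangle x y z → Triangle y x z
  swap₁₂ (xy , yz , xz) = ~-sym xy , xz , yz

  rotate : ∀ {x y z} → Triangle x y z → Triangle y z x
  rotate (xy , yz , xz) = yz , ~-sym xz , ~-sym xy

  swap₂₃ : ∀ {x y z} → Triangle x y z → Triangle x z y
  swap₂₃ (xy , yz , xz) = xz , ~-sym yz , xy

  PrivateNbr : V → V → V → V → Set
  PrivateNbr x y z w = x ~ w × y ≁ w × z ≁ w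

  isPrivate : V → V → V → V → Bool
  isPrivate x y z w = A x w ∧ not (A y w) ∧ not (A z w)

  privateCount : V → V → V → ℕ
  privateCount x y z = count (isPrivate x y z)

  isPrivate-T : ∀ {x y z w} → PrivateNbr x y z w → T (isPrivate x y z w)
  isPrivate-T (xw , y≁w , z≁w) = T-∧⁺ xw (T-∧⁺ (¬T⇒T-not y≁w) (¬T⇒T-not z≁w))

  isPrivate-elim : ∀ {x y z w} → T (isPrivate x y z w) → PrivateNbr x y z w
  isPrivate-elim {x} {y} {z} {w} t =
    let xw , t′ = T-∧⁻ {A x w} t ; yw , zw = T-∧⁻ {not (A y w)} t′ in xw , T-not⇒¬T yw , T-not⇒¬T zw

  private-common-nbrs : ∀ {x y z w} → Triangle x y z → PrivateNbr x y z w →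
                        codeg w x ≡ 0 × (∀ {c} → w ~ c → y ~ c → c ≡ x)
  private-common-nbrs {x} {y} {z} {w} (xy , yz , xz) (xw , y≁w , z≁w) =
    a+b≡1 (proj₂ heavy) (common⇒1≤codeg yz xz) ,
    λ wc yc → count≤1⇒unique (common w y) (≤-reflexive (proj₁ heavy)) (T-∧⁺ wc yc) x-common
    where
    x-common : T (common w y x)
    x-common = T-∧⁺ (~-sym xw) (~-sym xy)
    w≢y : w ≢ y
    w≢y refl = z≁w (~-sym yz)
    heavy : count (common w y) ≡ 1 × codeg w x + codeg y x ≡ 1
    heavy = weighted-count≡2⇒singleton (common w y) (λ c → codeg w c + codeg y c)
              (pathWeights≡2 w≢y (y≁w ∘ ~-sym)) x-common
              (≤-trans (common⇒1≤codeg yz xz) (m≤n+m _ _))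
    a+b≡1 : ∀ {a b} → a + b ≡ 1 → 1 ≤ b → a ≡ 0
    a+b≡1 {zero}  _  _   = refl
    a+b≡1 {suc a} eq b≥1 = ⊥-elim (n>0⇒n≢0 b≥1 (m+n≡0⇒n≡0 a (suc-injective eq)))

  one-triangle-per-vertex : ∀ {w r d r′ d′} → w ~ r → w ~ d → r ~ d → w ~ r′ → w ~ d′ → r′ ~ d′ →
                            r′ ≡ r ⊎ r′ ≡ d
  one-triangle-per-vertex {w} {r} {d} {r′} {d′} wr wd rd wr′ wd′ r′d′ with r′ ≟ r | r′ ≟ d
  ... | yes r′≡r | _        = inj₁ r′≡r
  ... | no _     | yes r′≡d = inj₂ r′≡d
  ... | no r′≢r  | no r′≢d  with T? (A r′ r)
  ...   | yes r′r = contradiction (apex-unique wr (~-sym wd) (~-sym rd) (~-sym wr′) r′r) (r′≢d ∘ sym)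
  ...   | no r′≁r = contradiction (≤-trans three≤weight (term≤sum (pathWeight r′ r) w))
                      (subst (λ s → ¬ 3 ≤ s) (sym (pathWeights≡2 r′≢r r′≁r)) λ { (s≤s (s≤s ())) })
    where
    three≤weight : 3 ≤ pathWeight r′ r w
    three≤weight = subst (3 ≤_) (sym (⊙-T _ (T-∧⁺ (~-sym wr′) (~-sym wr))))
                     (s≤s (+-mono-≤ (common⇒1≤codeg r′d′ wd′) (common⇒1≤codeg rd wd)))

  -- Twice the number of triangles at w.
  triangleDegree : V → ℕ
  triangleDegree w = sum λ r → A w r ⊙ codeg w r

  triangleDegree-cases : ∀ w → triangleDegree w ≡ 0 ⊎ triangleDegree w ≡ 2
  triangleDegree-cases w with 1 ≤? triangleDegree w
  ... | no  ¬pos = inj₁ (n<1⇒n≡0 (≰⇒> ¬pos))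
  ... | yes pos  with positive-term (λ r → A w r ⊙ codeg w r) pos
  ...   | r , pos with ⊙-pos (A w r) pos
  ...     | wr , codeg-pos with 1≤codeg⇒common codeg-pos
  ...       | d , wd , rd = inj₂ (trans (sum-pair r d (~⇒≢ rd) others)
                              (cong₂ _+_ (trans (⊙-T _ wr) (codeg≡1 wr wd rd))
                                         (trans (⊙-T _ wd) (codeg≡1 wd wr (~-sym rd)))))
    where
    others : ∀ k → k ≢ r → k ≢ d → A w k ⊙ codeg w k ≡ 0
    others k k≢r k≢d with T? (A w k)
    ... | no  w≁k = ⊙-¬T _ w≁k
    ... | yes wk  = trans (⊙-T _ wk) (no-common⇒codeg≡0 λ wd′ kd′ →
                      [ k≢r , k≢d ]′ (one-triangle-per-vertex wr wd rd wk wd′ kd′))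

  deg : V → ℕ
  deg w = count (A w)

  module PrivateCounts {x y z w} (xyz : Triangle x y z) (w-private : PrivateNbr x y z w) where

    private
      x~y : x ~ y
      x~y = proj₁ xyz
      y~z : y ~ z
      y~z = proj₁ (proj₂ xyz)
      x~z : x ~ z
      x~z = proj₂ (proj₂ xyz)
      x~w : x ~ w
      x~w = proj₁ w-private
      y≁w : y ≁ w
      y≁w = proj₁ (proj₂ w-private)
      z≁w : z ≁ w
      z≁w = proj₂ (proj₂ w-private)

    codeg-wx≡0 : codeg w x ≡ 0
    codeg-wx≡0 = proj₁ (private-common-nbrs xyz w-private)

    common-with-y≡x : ∀ {c} → w ~ c → y ~ c → c ≡ x
    common-with-y≡x = proj₂ (private-common-nbrs xyz w-private)

    common-with-z≡x : ∀ {c} → w ~ c → z ~ c → c ≡ x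
    common-with-z≡x = proj₂ (private-common-nbrs (swap₂₃ xyz) (x~w , z≁w , y≁w))

    x≁nbr-of-w : ∀ {r} → w ~ r → x ≁ r
    x≁nbr-of-w wr xr = n>0⇒n≢0 (common⇒1≤codeg wr xr) codeg-wx≡0

    private-of-x : ∀ {r c} → w ~ r → r ≢ x → r ~ c → x ~ c → PrivateNbr x y z c
    private-of-x {r} {c} wr r≢x rc xc = xc , y≁c , z≁c
      where
      y≁c : y ≁ c
      y≁c yc = r≢x (common-with-z≡x wr (~-sym (subst (r ~_) c≡z rc)))
        where
        c≡z : c ≡ z
        c≡z = apex-unique x~y (~-sym xc) (~-sym yc) (~-sym x~z) (~-sym y~z)
      z≁c : z ≁ c
      z≁c zc = r≢x (common-with-y≡x wr (~-sym (subst (r ~_) c≡y rc)))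
        where
        c≡y : c ≡ y
        c≡y = apex-unique x~z (~-sym xc) (~-sym zc) (~-sym x~y) y~z

    private-of-y : ∀ {r c} → w ~ r → r ≢ x → r ~ c → y ~ c → PrivateNbr y x z c
    private-of-y {r} {c} wr r≢x rc yc = yc , x≁c , z≁c
      where
      x≁c : x ≁ c
      x≁c xc = r≢x (common-with-z≡x wr (~-sym (subst (r ~_) c≡z rc)))
        where
        c≡z : c ≡ z
        c≡z = apex-unique x~y (~-sym xc) (~-sym yc) (~-sym x~z) (~-sym y~z)
      z≁c : z ≁ c
      z≁c zc = x≁nbr-of-w wr (~-sym (subst (r ~_) c≡x rc))
        where
        c≡x : c ≡ x
        c≡x = apex-unique y~z (~-sym yc) (~-sym zc) x~y x~z

    otherNbr : V → Bool
    otherNbr r = (r ≠ᵇ x) ∧ A w r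

    otherNbr-elim : ∀ {r} → T (otherNbr r) → r ≢ x × w ~ r
    otherNbr-elim {r} t = let r≠x , wr = T-∧⁻ {r ≠ᵇ x} t in toWitnessFalse r≠x , wr

    split-nbrs-at-x : (f : V → ℕ) → sum (λ r → A w r ⊙ f r) ≡ f x + sum (λ r → otherNbr r ⊙ f r)
    split-nbrs-at-x f = trans (sum-split (λ r → A w r ⊙ f r) x)
      (cong₂ _+_ (⊙-T _ (~-sym x~w)) (sum-cong-≗ λ r → sym (∧-⊙ (r ≠ᵇ x) (A w r) (f r))))

    deg-split : deg w ≡ 1 + count otherNbr
    deg-split = split-nbrs-at-x λ _ → 1

    triangleDegree-split : triangleDegree w ≡ sum λ r → otherNbr r ⊙ codeg w r
    triangleDegree-split =
      trans (split-nbrs-at-x (codeg w)) (cong (_+ sum (λ r → otherNbr r ⊙ codeg w r)) codeg-wx≡0)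

    unique-link : ∀ {w′} → PrivateNbr x y z w′ → w′ ≢ w → sum (λ r → otherNbr r ⊙ A w′ r ⊙ 1) ≡ 1
    unique-link {w′} w′-private w′≢w = +-cancelˡ-≡ 1 _ _ (begin
      1 + sum (λ r → otherNbr r ⊙ A w′ r ⊙ 1)
        ≡⟨ cong (_+ sum (λ r → otherNbr r ⊙ A w′ r ⊙ 1)) (⊙-T 1 (~-sym (proj₁ w′-private))) ⟨
      A w′ x ⊙ 1 + sum (λ r → otherNbr r ⊙ A w′ r ⊙ 1)
        ≡⟨ split-nbrs-at-x (λ r → A w′ r ⊙ 1) ⟨
      sum (λ r → A w r ⊙ A w′ r ⊙ 1)      ≡⟨ sum-cong-≗ (λ r → ∧-⊙ (A w r) (A w′ r) 1) ⟨
      count (common w w′)                 ≡⟨ +-identityʳ _ ⟨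
      count (common w w′) + 0             ≡⟨ cong (count (common w w′) +_) (cong₂ _+_ codeg-wx≡0 codeg-w′x) ⟨
      count (common w w′) + (codeg w x + codeg w′ x)
        ≡⟨ weighted-count≡2 (common w w′) (λ c → codeg w c + codeg w′ c)
             (pathWeights≡2 (w′≢w ∘ sym) w≁w′) (T-∧⁺ (~-sym x~w) (~-sym (proj₁ w′-private))) ⟩
      2                                   ∎)
      where
      open ≡-Reasoning
      codeg-w′x : codeg w′ x ≡ 0
      codeg-w′x = proj₁ (private-common-nbrs xyz w′-private)
      w≁w′ : w ≁ w′
      w≁w′ ww′ = x≁nbr-of-w ww′ (proj₁ w′-private)

    Links : ℕ
    Links = sum λ w′ → isPrivate x y z w′ ⊙ sum (λ r → otherNbr r ⊙ A w′ r ⊙ 1)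

    links-by-private : Links + 1 ≡ privateCount x y z + count otherNbr
    links-by-private = begin
      Links + 1
        ≡⟨ cong (_+ 1) (sum-split _ w) ⟩
      isPrivate x y z w ⊙ sum (λ r → otherNbr r ⊙ A w r ⊙ 1) + S′ + 1
        ≡⟨ cong (λ s → s + S′ + 1) (trans (⊙-T _ (isPrivate-T w-private))
             (sum-⊙-cong otherNbr λ r t → ⊙-T 1 (proj₂ (otherNbr-elim t)))) ⟩
      count otherNbr + S′ + 1
        ≡⟨ trans (+-comm (count otherNbr + S′) 1) (cong suc (+-comm (count otherNbr) S′)) ⟩
      1 + S′ + count otherNbr
        ≡⟨ cong (_+ count otherNbr) (cong₂ _+_ (⊙-T 1 (isPrivate-T w-private)) (sym (sum-cong-≗ others))) ⟨
      isPrivate x y z w ⊙ 1 + sum (λ w′ → (w′ ≠ᵇ w) ⊙ isPrivate x y z w′ ⊙ 1) + count otherNbr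
        ≡⟨ cong (_+ count otherNbr) (sum-split _ w) ⟨
      privateCount x y z + count otherNbr ∎
      where
      open ≡-Reasoning
      S′ : ℕ
      S′ = sum λ w′ → (w′ ≠ᵇ w) ⊙ isPrivate x y z w′ ⊙ sum (λ r → otherNbr r ⊙ A w′ r ⊙ 1)
      others : ∀ w′ → (w′ ≠ᵇ w) ⊙ isPrivate x y z w′ ⊙ sum (λ r → otherNbr r ⊙ A w′ r ⊙ 1)
                      ≡ (w′ ≠ᵇ w) ⊙ isPrivate x y z w′ ⊙ 1
      others w′ = ⊙-cong (w′ ≠ᵇ w) λ t → ⊙-cong (isPrivate x y z w′) λ p →
                    unique-link (isPrivate-elim p) (toWitnessFalse t)

    links-by-nbr : Links ≡ sum λ r → otherNbr r ⊙ codeg r x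
    links-by-nbr = trans (double-count (isPrivate x y z) otherNbr (λ w′ r → A w′ r ⊙ 1))
                         (sum-⊙-cong otherNbr λ r t → sum-cong-≗ (same-indicator (otherNbr-elim t)))
      where
      same-indicator : ∀ {r} → r ≢ x × w ~ r → ∀ c → isPrivate x y z c ⊙ A c r ⊙ 1 ≡ common r x c ⊙ 1
      same-indicator {r} (r≢x , wr) c =
        trans (sym (∧-⊙ (isPrivate x y z c) (A c r) 1)) (cong (_⊙ 1) (T-ext to from))
        where
        to : T (isPrivate x y z c ∧ A c r) → T (common r x c)
        to t = let p , cr = T-∧⁻ {isPrivate x y z c} t in T-∧⁺ (~-sym cr) (proj₁ (isPrivate-elim p))
        from : T (common r x c) → T (isPrivate x y z c ∧ A c r)
        from t = let rc , xc = T-∧⁻ {A r c} t in T-∧⁺ (isPrivate-T (private-of-x wr r≢x rc xc)) (~-sym rc)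

    codeg-complement : ∀ {r} → T (otherNbr r) → codeg r x + codeg w r ≡ 2
    codeg-complement {r} t = begin
      codeg r x + codeg w r
        ≡⟨ cong (codeg r x +_) (+-identityʳ (codeg w r)) ⟨
      codeg r x + (codeg w r + 0)
        ≡⟨ cong (codeg r x +_) (cong₂ _+_ (codeg-sym r w) (trans (codeg-sym x w) codeg-wx≡0)) ⟨
      codeg r x + (codeg r w + codeg x w)
        ≡⟨ weighted-count≡2 (common r x) (λ c → codeg r c + codeg x c)
             (pathWeights≡2 r≢x r≁x) (T-∧⁺ (~-sym wr) x~w) ⟩
      2                                            ∎
      where
      open ≡-Reasoning
      r≢x : r ≢ x
      r≢x = proj₁ (otherNbr-elim t)
      wr : w ~ r
      wr = proj₂ (otherNbr-elim t)
      r≁x : r ≁ x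
      r≁x rx = x≁nbr-of-w wr (~-sym rx)

    links+triangleDegree : Links + triangleDegree w ≡ 2 * count otherNbr
    links+triangleDegree = begin
      Links + triangleDegree w
        ≡⟨ cong₂ _+_ links-by-nbr triangleDegree-split ⟩
      sum (λ r → otherNbr r ⊙ codeg r x) + sum (λ r → otherNbr r ⊙ codeg w r)
        ≡⟨ ∑-distrib-+ (λ r → otherNbr r ⊙ codeg r x) (λ r → otherNbr r ⊙ codeg w r) ⟨
      sum (λ r → otherNbr r ⊙ codeg r x + otherNbr r ⊙ codeg w r)
        ≡⟨ sum-cong-≗ (λ r → trans (sym (⊙-+ (otherNbr r) _ _)) (⊙-cong (otherNbr r) codeg-complement)) ⟩
      sum (λ r → otherNbr r ⊙ 2)
        ≡⟨ sum-cong-≗ (λ r → ⊙-*ˡ (otherNbr r) 2 1) ⟩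
      sum (λ r → 2 * (otherNbr r ⊙ 1))
        ≡⟨ sum-*ˡ 2 (λ r → otherNbr r ⊙ 1) ⟩
      2 * count otherNbr ∎
      where open ≡-Reasoning

    private-degree : privateCount x y z + triangleDegree w ≡ deg w
    private-degree = trans (arith links-by-private links+triangleDegree) (sym deg-split)
      where
      arith : ∀ {p t l c} → l + 1 ≡ p + c → l + t ≡ 2 * c → p + t ≡ 1 + c
      arith {p} {t} {l} {c} e₁ e₂ = +-cancelʳ-≡ c (p + t) (1 + c) (begin
        p + t + c    ≡⟨ xy∙z≈xz∙y p t c ⟩
        p + c + t    ≡⟨ cong (_+ t) e₁ ⟨
        l + 1 + t    ≡⟨ xy∙z≈xz∙y l 1 t ⟩
        l + t + 1    ≡⟨ cong (_+ 1) e₂ ⟩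
        2 * c + 1    ≡⟨ +-comm (2 * c) 1 ⟩
        1 + 2 * c    ≡⟨ cong (λ k → 1 + (c + k)) (+-identityʳ c) ⟩
        1 + c + c    ∎)
        where open ≡-Reasoning

    private-y-weights : ∀ {r} → w ~ r → r ≢ x → sum (λ u → isPrivate y x z u ⊙ A u r ⊙ suc (codeg u r)) ≡ 2
    private-y-weights {r} wr r≢x = trans (sym (sum-cong-≗ same)) (pathWeights≡2 r≢y r≁y)
      where
      r≢y : r ≢ y
      r≢y refl = y≁w (~-sym wr)
      r≁y : r ≁ y
      r≁y ry = r≢x (common-with-y≡x wr (~-sym ry))
      same : ∀ c → pathWeight r y c ≡ isPrivate y x z c ⊙ A c r ⊙ suc (codeg c r)
      same c with T? (A r c) | T? (A y c)
      ... | no r≁c | _ = trans (⊙-¬T _ λ t → r≁c (proj₁ (T-∧⁻ {A r c} t)))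
        (sym (trans (⊙-cong (isPrivate y x z c) λ _ → ⊙-¬T _ (r≁c ∘ ~-sym)) (⊙-zeroʳ _)))
      ... | yes rc | no y≁c = trans (⊙-¬T _ λ t → y≁c (proj₂ (T-∧⁻ {A r c} t)))
        (sym (⊙-¬T _ λ p → y≁c (proj₁ (isPrivate-elim p))))
      ... | yes rc | yes yc = trans (⊙-T _ (T-∧⁺ rc yc))
        (trans (cong suc (trans (cong₂ _+_ (codeg-sym r c) codeg-yc) (+-identityʳ _)))
        (sym (trans (⊙-T _ (isPrivate-T c-private)) (⊙-T _ (~-sym rc)))))
        where
        c-private : PrivateNbr y x z c
        c-private = private-of-y wr r≢x rc yc
        codeg-yc : codeg y c ≡ 0
        codeg-yc = trans (codeg-sym y c) (proj₁ (private-common-nbrs (swap₁₂ xyz) c-private))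

    triangle-at⇒codeg≡0 : ∀ {r u} → w ~ r → codeg w r ≡ 1 → PrivateNbr y x z u → u ~ r → codeg u r ≡ 0
    triangle-at⇒codeg≡0 {r} {u} wr one (yu , _ , _) ur with 1≤codeg⇒common (subst (1 ≤_) (sym one) (s≤s z≤n))
    ... | d , wd , rd = no-common⇒codeg≡0 λ ud′ rd′ →
      [ (λ u≡w → y≁w (subst (y ~_) u≡w yu)) , (λ u≡d → x≁nbr-of-w wr (~-sym (subst (r ~_) (d≡x u≡d) rd))) ]′
      (one-triangle-per-vertex (~-sym wr) rd wd (~-sym ur) rd′ ud′)
      where
      d≡x : u ≡ d → d ≡ x
      d≡x u≡d = common-with-y≡x wd (subst (y ~_) u≡d yu)

    private-y-weights-from-w : ∀ {r} → w ~ r → r ≢ x →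
      sum (λ u → isPrivate y x z u ⊙ A u r ⊙ suc (codeg w r + codeg u r)) ≡ 2 * suc (codeg w r)
    private-y-weights-from-w {r} wr r≢x with n≤1⇒n≡0∨n≡1 (codeg≤1 wr)
    ... | inj₁ none rewrite none = private-y-weights wr r≢x
    ... | inj₂ one  rewrite one  = begin
      sum (λ u → isPrivate y x z u ⊙ A u r ⊙ suc (1 + codeg u r))
        ≡⟨ sum-cong-≗ (λ u → ⊙-cong (isPrivate y x z u) λ p → ⊙-cong (A u r) λ ur →
             cong (λ k → suc (1 + k)) (triangle-at⇒codeg≡0 wr one (isPrivate-elim p) ur)) ⟩
      sum (λ u → isPrivate y x z u ⊙ A u r ⊙ 2)
        ≡⟨ sum-cong-≗ (λ u → trans (cong (isPrivate y x z u ⊙_) (⊙-*ˡ (A u r) 2 1))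
                                   (⊙-*ˡ (isPrivate y x z u) 2 (A u r ⊙ 1))) ⟩
      sum (λ u → 2 * (isPrivate y x z u ⊙ A u r ⊙ 1))
        ≡⟨ sum-*ˡ 2 (λ u → isPrivate y x z u ⊙ A u r ⊙ 1) ⟩
      2 * sum (λ u → isPrivate y x z u ⊙ A u r ⊙ 1)
        ≡⟨ cong (2 *_) (trans (sum-cong-≗ λ u → ⊙-cong (isPrivate y x z u) λ p → ⊙-cong (A u r) λ ur →
             cong suc (sym (triangle-at⇒codeg≡0 wr one (isPrivate-elim p) ur))) (private-y-weights wr r≢x)) ⟩
      2 * 2 ∎
      where open ≡-Reasoning

    private-y-weights-at : ∀ r → A w r ⊙ sum (λ u → isPrivate y x z u ⊙ A u r ⊙ suc (codeg w r + codeg u r))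
                       ≡ 2 * (otherNbr r ⊙ suc (codeg w r))
    private-y-weights-at r with T? (A w r)
    ... | no w≁r = trans (⊙-¬T _ w≁r) (sym (cong (2 *_) (⊙-¬T _ (w≁r ∘ proj₂ ∘ otherNbr-elim))))
    ... | yes wr with r ≟ x
    ...   | yes refl = trans (⊙-T _ wr) (sum-zero λ u →
            trans (⊙-cong (isPrivate y x z u) λ p → ⊙-¬T _ λ ux → proj₁ (proj₂ (isPrivate-elim p)) (~-sym ux))
                  (⊙-zeroʳ (isPrivate y x z u)))
    ...   | no r≢x = trans (⊙-T _ wr) (trans (private-y-weights-from-w wr r≢x) (cong (2 *_) (sym (⊙-T _ wr))))

    private-y-count : privateCount y x z ≡ count otherNbr + triangleDegree w
    private-y-count = *-cancelˡ-≡ _ _ 2 (begin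
      2 * privateCount y x z
        ≡⟨ sum-*ˡ 2 (λ u → isPrivate y x z u ⊙ 1) ⟨
      sum (λ u → 2 * (isPrivate y x z u ⊙ 1))
        ≡⟨ sum-cong-≗ (λ u → ⊙-*ˡ (isPrivate y x z u) 2 1) ⟨
      sum (λ u → isPrivate y x z u ⊙ 2)
        ≡⟨ sum-⊙-cong (isPrivate y x z) (λ u p → sym (paths-to u (isPrivate-elim p))) ⟩
      sum (λ u → isPrivate y x z u ⊙ sum (λ r → A w r ⊙ A u r ⊙ suc (codeg w r + codeg u r)))
        ≡⟨ double-count (isPrivate y x z) (A w) (λ u r → A u r ⊙ suc (codeg w r + codeg u r)) ⟩
      sum (λ r → A w r ⊙ sum (λ u → isPrivate y x z u ⊙ A u r ⊙ suc (codeg w r + codeg u r)))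
        ≡⟨ sum-cong-≗ private-y-weights-at ⟩
      sum (λ r → 2 * (otherNbr r ⊙ suc (codeg w r)))
        ≡⟨ sum-*ˡ 2 (λ r → otherNbr r ⊙ suc (codeg w r)) ⟩
      2 * sum (λ r → otherNbr r ⊙ suc (codeg w r))
        ≡⟨ cong (2 *_) (sum-⊙-suc otherNbr (codeg w)) ⟩
      2 * (count otherNbr + sum (λ r → otherNbr r ⊙ codeg w r))
        ≡⟨ cong (λ t → 2 * (count otherNbr + t)) triangleDegree-split ⟨
      2 * (count otherNbr + triangleDegree w) ∎)
      where
      open ≡-Reasoning
      paths-to : ∀ u → PrivateNbr y x z u → sum (λ r → A w r ⊙ A u r ⊙ suc (codeg w r + codeg u r)) ≡ 2
      paths-to u (yu , x≁u , z≁u) =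
        trans (sum-cong-≗ λ r → sym (∧-⊙ (A w r) (A u r) _)) (pathWeights≡2 w≢u w≁u)
        where
        w≢u : w ≢ u
        w≢u refl = y≁w yu
        w≁u : w ≁ u
        w≁u wu = z≁u (subst (z ~_) (sym (common-with-y≡x wu yu)) (~-sym x~z))

    private-balance : privateCount y x z + 1 ≡ privateCount x y z + 2 * triangleDegree w
    private-balance = begin
      privateCount y x z + 1        ≡⟨ cong (_+ 1) private-y-count ⟩
      count otherNbr + t + 1        ≡⟨ +-comm (count otherNbr + t) 1 ⟩
      1 + count otherNbr + t        ≡⟨ cong (_+ t) (trans (sym deg-split) (sym private-degree)) ⟩
      privateCount x y z + t + t    ≡⟨ +-assoc (privateCount x y z) t t ⟩
      privateCount x y z + (t + t)  ≡⟨ cong (λ k → privateCount x y z + (t + k)) (+-identityʳ t) ⟨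
      privateCount x y z + 2 * t    ∎
      where
      open ≡-Reasoning
      t : ℕ
      t = triangleDegree w

  private-swap : ∀ {x y z w} → PrivateNbr x y z w → PrivateNbr x z y w
  private-swap (xw , y≁w , z≁w) = xw , z≁w , y≁w

  two-private-classes : ∀ {x y z w u} → Triangle x y z → PrivateNbr x y z w → PrivateNbr y x z u → ⊥
  two-private-classes {x} {y} {z} {w} {u} xyz w-private u-private =
    parity (PrivateCounts.private-balance xyz w-private)
           (PrivateCounts.private-balance (swap₁₂ xyz) u-private)
           (triangleDegree-cases w) (triangleDegree-cases u)
    where
    parity : ∀ {a b m k} → a + 1 ≡ b + 2 * m → b + 1 ≡ a + 2 * k → m ≡ 0 ⊎ m ≡ 2 → k ≡ 0 ⊎ k ≡ 2 → ⊥
    parity {a} {b} {m} {k} e₁ e₂ m-even k-even =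
      impossible m-even k-even (+-cancelˡ-≡ (a + b) 2 (2 * m + 2 * k) (begin
      a + b + 2                     ≡⟨ regroup₁ a b ⟩
      a + 1 + (b + 1)               ≡⟨ +-comm (a + 1) (b + 1) ⟩
      b + 1 + (a + 1)               ≡⟨ cong₂ _+_ e₂ e₁ ⟩
      a + 2 * k + (b + 2 * m)       ≡⟨ regroup₂ a b m k ⟩
      a + b + (2 * m + 2 * k)       ∎))
      where
      open ≡-Reasoning
      regroup₁ : ∀ a b → a + b + 2 ≡ a + 1 + (b + 1)
      regroup₁ = solve-∀
      regroup₂ : ∀ a b m k → a + 2 * k + (b + 2 * m) ≡ a + b + (2 * m + 2 * k)
      regroup₂ = solve-∀
      impossible : m ≡ 0 ⊎ m ≡ 2 → k ≡ 0 ⊎ k ≡ 2 → 2 ≢ 2 * m + 2 * k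
      impossible (inj₁ refl) (inj₁ refl) ()
      impossible (inj₁ refl) (inj₂ refl) ()
      impossible (inj₂ refl) (inj₁ refl) ()
      impossible (inj₂ refl) (inj₂ refl) ()

  module TwoEmptyClasses {p q s} (pqs : Triangle p q s)
    (no-q : ∀ v → ¬ PrivateNbr q p s v) (no-s : ∀ v → ¬ PrivateNbr s p q v) where

    private
      p~q : p ~ q
      p~q = proj₁ pqs
      q~s : q ~ s
      q~s = proj₁ (proj₂ pqs)
      p~s : p ~ s
      p~s = proj₂ (proj₂ pqs)

    q-nbrs : ∀ {c} → q ~ c → c ≡ p ⊎ c ≡ s
    q-nbrs {c} qc with c ≟ p | c ≟ s
    ... | yes c≡p | _       = inj₁ c≡p
    ... | no _    | yes c≡s = inj₂ c≡s
    ... | no c≢p  | no c≢s  = ⊥-elim (no-q c (qc , p≁c , s≁c))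
      where
      p≁c : p ≁ c
      p≁c pc = c≢s (apex-unique p~q (~-sym pc) (~-sym qc) (~-sym p~s) (~-sym q~s))
      s≁c : s ≁ c
      s≁c sc = c≢p (apex-unique q~s (~-sym qc) (~-sym sc) p~q p~s)

    s-nbrs : ∀ {c} → s ~ c → c ≡ p ⊎ c ≡ q
    s-nbrs {c} sc with c ≟ p | c ≟ q
    ... | yes c≡p | _       = inj₁ c≡p
    ... | no _    | yes c≡q = inj₂ c≡q
    ... | no c≢p  | no c≢q  = ⊥-elim (no-s c (sc , p≁c , q≁c))
      where
      p≁c : p ≁ c
      p≁c pc = c≢q (apex-unique p~s (~-sym pc) (~-sym sc) (~-sym p~q) q~s)
      q≁c : q ≁ c
      q≁c qc = c≢p (apex-unique q~s (~-sym qc) (~-sym sc) p~q p~s)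

    outsider-private : ∀ {v} → v ≢ p → v ≢ q → v ≢ s → PrivateNbr p q s v
    outsider-private {v} v≢p v≢q v≢s = p~v , q≁v , s≁v
      where
      q≁v : q ≁ v
      q≁v qv = [ v≢p , v≢s ]′ (q-nbrs qv)
      s≁v : s ≁ v
      s≁v sv = [ v≢p , v≢q ]′ (s-nbrs sv)
      p~v : p ~ v
      p~v = via-common (positive-term (pathWeight v q)
                         (subst (1 ≤_) (sym (pathWeights≡2 v≢q (q≁v ∘ ~-sym))) (s≤s z≤n)))
        where
        via-common : ∃ (λ c → 1 ≤ pathWeight v q c) → p ~ v
        via-common (c , pos) with T-∧⁻ {A v c} (proj₁ (⊙-pos (common v q c) pos))
        ... | vc , qc with q-nbrs qc
        ...   | inj₁ refl = ~-sym vc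
        ...   | inj₂ refl = ⊥-elim (s≁v (~-sym vc))

    private-pendant : ∀ {v t} → PrivateNbr p q s v → v ~ t → t ≡ p
    private-pendant {v} {t} v-private@(_ , q≁v , s≁v) vt with t ≟ p | t ≟ q | t ≟ s
    ... | yes t≡p | _        | _        = t≡p
    ... | no _    | yes refl | _        = ⊥-elim (q≁v (~-sym vt))
    ... | no _    | no _     | yes refl = ⊥-elim (s≁v (~-sym vt))
    ... | no t≢p  | no t≢q   | no t≢s   =
      ⊥-elim (n>0⇒n≢0 (common⇒1≤codeg vt (proj₁ (outsider-private t≢p t≢q t≢s)))
                      (proj₁ (private-common-nbrs pqs v-private)))

    no-outside-triangle : ∀ {v a b} → v ≢ p → v ≢ q → v ≢ s → Triangle v a b → ⊥
    no-outside-triangle {v} v≢p v≢q v≢s (va , ab , vb) =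
      ~⇒≢ ab (trans (private-pendant v-private va) (sym (private-pendant v-private vb)))
      where
      v-private : PrivateNbr p q s v
      v-private = outsider-private v≢p v≢q v≢s

  private? : ∀ x y z → Dec (∃ (PrivateNbr x y z))
  private? x y z = map′ (λ (v , t) → v , isPrivate-elim t) (λ (v , p) → v , isPrivate-T p)
                        (any? λ v → T? (isPrivate x y z v))

  no-outsider : ∀ {x y z v a b} → Triangle x y z → v ≢ x → v ≢ y → v ≢ z → Triangle v a b → ⊥
  no-outsider {x} {y} {z} xyz v≢x v≢y v≢z vab with private? x y z | private? y x z | private? z x y
  ... | yes (_ , w) | yes (_ , u) | _           = two-private-classes xyz w u
  ... | yes (_ , w) | no _        | yes (_ , u) = two-private-classes (swap₂₃ xyz) (private-swap w) u
  ... | no _        | yes (_ , w) | yes (_ , u) =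
        two-private-classes (rotate xyz) (private-swap w) (private-swap u)
  ... | yes _       | no ¬y       | no ¬z       = TwoEmptyClasses.no-outside-triangle xyz
        (λ v p → ¬y (v , p)) (λ v p → ¬z (v , p)) v≢x v≢y v≢z vab
  ... | no ¬x       | yes _       | no ¬z       = TwoEmptyClasses.no-outside-triangle (swap₁₂ xyz)
        (λ v p → ¬x (v , p)) (λ v p → ¬z (v , private-swap p)) v≢y v≢x v≢z vab
  ... | no ¬x       | no ¬y       | _           = TwoEmptyClasses.no-outside-triangle (rotate (rotate xyz))
        (λ v p → ¬x (v , private-swap p)) (λ v p → ¬y (v , private-swap p)) v≢z v≢x v≢y vab

  triangleTerm : V → V → V → ℕ
  triangleTerm i j k = 𝟙 ((i <ᵇ j) ∧ (j <ᵇ k) ∧ A i j ∧ A j k ∧ A i k)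

  triangleCount≡ : triangleCount A ≡ sum λ i → sum λ j → sum λ k → triangleTerm i j k
  triangleCount≡ =
    trans (Σv≡sum λ i → Σv λ j → Σv λ k → triangleTerm i j k) (sum-cong-≗ λ i →
    trans (Σv≡sum λ j → Σv λ k → triangleTerm i j k) (sum-cong-≗ λ j →
    Σv≡sum λ k → triangleTerm i j k))

  SortedTriangle : V → V → V → Set
  SortedTriangle i j k = i < j × j < k × Triangle i j k

  triangleTerm-sorted : ∀ {i j k} → 1 ≤ triangleTerm i j k → SortedTriangle i j k
  triangleTerm-sorted {i} {j} {k} pos =
    let i<j , t  = T-∧⁻ {i <ᵇ j} (𝟙-pos⇒T pos)
        j<k , t  = T-∧⁻ {j <ᵇ k} t
        ij  , t  = T-∧⁻ {A i j} t
        jk  , ik = T-∧⁻ {A j k} t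
    in toWitness i<j , toWitness j<k , ij , jk , ik

  triangleTerm≤1 : ∀ i j k → triangleTerm i j k ≤ 1
  triangleTerm≤1 i j k = 𝟙≤1 ((i <ᵇ j) ∧ (j <ᵇ k) ∧ A i j ∧ A j k ∧ A i k)

  sorted-in₁ : ∀ {i j} → 1 ≤ sum (triangleTerm i j) → ∃ (SortedTriangle i j)
  sorted-in₁ {i} {j} pos with positive-term (triangleTerm i j) pos
  ... | k , pos′ = k , triangleTerm-sorted pos′

  sorted-in₂ : ∀ {i} → 1 ≤ sum (λ j → sum (triangleTerm i j)) → ∃₂ (SortedTriangle i)
  sorted-in₂ {i} pos with positive-term (λ j → sum (triangleTerm i j)) pos
  ... | j , pos′ = j , sorted-in₁ pos′

  different-first : ∀ {i j k i′ j′ k′} → i ≢ i′ → SortedTriangle i j k → SortedTriangle i′ j′ k′ → ⊥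
  different-first {i} {i′ = i′} i≢i′ (i<j , j<k , ijk) (i′<j′ , j′<k′ , ijk′) with <-cmp i i′
  ... | tri< i<i′ _ _ = no-outsider ijk′ (<⇒≢ i<i′) (<⇒≢ (<-trans i<i′ i′<j′))
                          (<⇒≢ (<-trans i<i′ (<-trans i′<j′ j′<k′))) ijk
  ... | tri≈ _ i≡i′ _ = i≢i′ i≡i′
  ... | tri> _ _ i′<i = no-outsider ijk (<⇒≢ i′<i) (<⇒≢ (<-trans i′<i i<j))
                          (<⇒≢ (<-trans i′<i (<-trans i<j j<k))) ijk′

  different-second : ∀ {i j k j′ k′} → j ≢ j′ → SortedTriangle i j k → SortedTriangle i j′ k′ → ⊥
  different-second {j = j} {j′ = j′} j≢j′ (i<j , j<k , ijk) (i<j′ , j′<k′ , ijk′) with <-cmp j j′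
  ... | tri< j<j′ _ _ = no-outsider ijk′ (<⇒≢ i<j ∘ sym) (<⇒≢ j<j′) (<⇒≢ (<-trans j<j′ j′<k′)) (swap₁₂ ijk)
  ... | tri≈ _ j≡j′ _ = j≢j′ j≡j′
  ... | tri> _ _ j′<j = no-outsider ijk (<⇒≢ i<j′ ∘ sym) (<⇒≢ j′<j) (<⇒≢ (<-trans j′<j j<k)) (swap₁₂ ijk′)

  different-third : ∀ {i j k k′} → k ≢ k′ → Triangle i j k → Triangle i j k′ → ⊥
  different-third k≢k′ (ij , jk , ik) (_ , jk′ , ik′) =
    k≢k′ (apex-unique ij (~-sym ik) (~-sym jk) (~-sym ik′) (~-sym jk′))

  triangleCount≤1 : triangleCount A ≤ 1
  triangleCount≤1 with triangleCount A ≤? 1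
  ... | yes ≤1 = ≤1
  ... | no  ≰1 = ⊥-elim (two-sorted (subst (2 ≤_) triangleCount≡ (≰⇒> ≰1)))
    where
    two-sorted : 2 ≤ sum (λ i → sum λ j → sum λ k → triangleTerm i j k) → ⊥
    two-sorted two≤ with 2≤sum-cases (λ i → sum λ j → sum λ k → triangleTerm i j k) two≤
    ... | inj₂ (i , i′ , i≢i′ , pos , pos′) =
      let j , k , t = sorted-in₂ pos ; j′ , k′ , t′ = sorted-in₂ pos′ in different-first i≢i′ t t′
    ... | inj₁ (i , two≤ᵢ) with 2≤sum-cases (λ j → sum λ k → triangleTerm i j k) two≤ᵢ
    ...   | inj₂ (j , j′ , j≢j′ , pos , pos′) =
      let k , t = sorted-in₁ pos ; k′ , t′ = sorted-in₁ pos′ in different-second j≢j′ t t′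
    ...   | inj₁ (j , two≤ⱼ) with 2≤sum-cases (triangleTerm i j) two≤ⱼ
    ...     | inj₂ (k , k′ , k≢k′ , pos , pos′) =
      different-third k≢k′ (proj₂ (proj₂ (triangleTerm-sorted {i} {j} {k} pos)))
                           (proj₂ (proj₂ (triangleTerm-sorted {i} {j} {k′} pos′)))
    ...     | inj₁ (k , two≤ₖ) = ¬2≤1 (≤-trans two≤ₖ (triangleTerm≤1 i j k))

mainTheorem15 : ¬ (Σ Graph λ G → UniquelyDiamondSaturated G × triangleCount (adj G) ≡ 4)
mainTheorem15 (G , (diamond-free , unique) , four-triangles) =
  contradiction (subst (_≤ 1) four-triangles at-most-one) λ { (s≤s ()) }
  where
  at-most-one : triangleCount (adj G) ≤ 1
  at-most-one = UniquelySaturated.triangleCount≤1 (adj G) (Graph.sym G) (irrefl G) diamond-free unique
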